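{- For all $\phi\in \mathrm{PL}(=\!(\cdot))$ and all $\mathsf{X}\supseteq \mathsf{P}(\phi)$, $|\phi|_\mathsf{X}=|\phi^f|_\mathsf{X}$.
   Context: Propositional dependence logic $\mathrm{PL}(=\!(\cdot))$: $\phi ::= p \mid \bot \mid \neg\phi \mid \phi\wedge\phi \mid \phi\vee\phi \mid {=}\!(p_1,\ldots,p_n,q)$ (dependence atoms), on propositional teams with support $\models$ / anti-support $\models^-$: $p$ supported iff all $w\in s$ make $p$ true, anti-supported iff none do; $s\models\bot$ iff $s=\emptyset$, $\bot$ always anti-supported; $s\models{=}\!(p_1,\ldots,p_n,q)$ iff any $v,w\in s$ agreeing on all $p_i$ agree on $q$, and $s\models^-{=}\!(p_1,\ldots,p_n,q)$ iff $s=\emptyset$; $\neg$ swaps support and anti-support; $\wedge$ supported iff both conjuncts are, anti-supported iff $s=t\cup u$ with $t\models^-\phi,u\models^-\psi$; $\vee$ supported iff $s=t\cup u$ with $t\models\phi,u\models\psi$, anti-supported iff both are. Flattening $\phi^f$: $p^f=p$, $\bot^f=\bot$, ${=}\!(p_1,\ldots,p_n,q)^f=\top$ ($\top:=\neg\bot$), $(\neg\phi)^f=\neg\phi^f$, $(\phi\wedge\psi)^f=\phi^f\wedge\psi^f$, $(\phi\vee\psi)^f=\phi^f\vee\psi^f$. Ground team $|\phi|_\mathsf{X}$: valuations over $\mathsf{X}$ belonging to some team over $\mathsf{X}$ supporting $\phi$. -}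

module Defs where

open import Data.Nat using (ℕ)
open import Data.Bool using (Bool; true; T)
open import Data.List using (List; []; _∷_; _++_)
open import Data.List.Relation.Unary.All using (All)
open import Data.Product using (Σ; _×_; _,_)
open import Data.Sum using (_⊎_)
open import Data.Empty using (⊥)
open import Level using (Level; suc; zero)
open import Relation.Binary.PropositionalEquality using (_≡_)
import Data.Unit

Var : Set
Var = ℕ

-- Formulas of PL(=(·)).  dep (p₁ ∷ … ∷ pₙ ∷ []) q  is  =(p₁,…,pₙ,q)  (n ≥ 0).
data Form : Set where
  var  : Var → Form
  ⊥f   : Form
  ¬f_  : Form → Form
  _∧f_ : Form → Form → Form
  _∨f_ : Form → Form → Form
  dep  : List Var → Var → Form

⊤f : Form
⊤f = ¬f ⊥f

P : Form → List Var
P (var p)   = p ∷ []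
P ⊥f        = []
P (¬f φ)    = P φ
P (φ ∧f ψ)  = P φ ++ P ψ
P (φ ∨f ψ)  = P φ ++ P ψ
P (dep ps q) = ps ++ (q ∷ [])

flat : Form → Form
flat (var p)    = var p
flat ⊥f         = ⊥f
flat (¬f φ)     = ¬f flat φ
flat (φ ∧f ψ)   = flat φ ∧f flat ψ
flat (φ ∨f ψ)   = flat φ ∨f flat ψ
flat (dep ps q) = ⊤f

VarSet : Set
VarSet = Var → Bool

_∈X_ : Var → VarSet → Set
p ∈X X = T (X p)

Val : VarSet → Set
Val X = (p : Var) → p ∈X X → Bool

Team : VarSet → Set₁
Team X = Val X → Set

module _ {X : VarSet} where

  EmptyT : Team X → Set
  EmptyT s = (v : Val X) → s v → ⊥

  IsUnion : Team X → Team X → Team X → Set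
  IsUnion s t u = (v : Val X) → (s v → t v ⊎ u v) × (t v ⊎ u v → s v)

  Agree : Val X → Val X → Var → Set
  Agree v w p = (h : p ∈X X) → v p h ≡ w p h

  mutual
    _⊨_ : Team X → Form → Set₁
    s ⊨ var p    = Level.Lift _ ((v : Val X) → s v → (h : p ∈X X) → v p h ≡ true)
    s ⊨ ⊥f       = Level.Lift _ (EmptyT s)
    s ⊨ (¬f φ)   = s ⊨⁻ φ
    s ⊨ (φ ∧f ψ) = (s ⊨ φ) × (s ⊨ ψ)
    s ⊨ (φ ∨f ψ) = Σ (Team X) λ t → Σ (Team X) λ u → IsUnion s t u × (t ⊨ φ) × (u ⊨ ψ)
    s ⊨ dep ps q = Level.Lift _ ((v w : Val X) → s v → s w →
                     All (Agree v w) ps → Agree v w q)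

    _⊨⁻_ : Team X → Form → Set₁
    s ⊨⁻ var p    = Level.Lift _ ((v : Val X) → s v → (h : p ∈X X) → v p h ≡ Data.Bool.false)
    s ⊨⁻ ⊥f       = Level.Lift _ Data.Unit.⊤
    s ⊨⁻ (¬f φ)   = s ⊨ φ
    s ⊨⁻ (φ ∧f ψ) = Σ (Team X) λ t → Σ (Team X) λ u → IsUnion s t u × (t ⊨⁻ φ) × (u ⊨⁻ ψ)
    s ⊨⁻ (φ ∨f ψ) = (s ⊨⁻ φ) × (s ⊨⁻ ψ)
    s ⊨⁻ dep ps q = Level.Lift _ (EmptyT s)

Ground : Form → (X : VarSet) → Val X → Set₁
Ground φ X v = Σ (Team X) λ s → (s ⊨ φ) × s v

_⊆X_ : List Var → VarSet → Set
ps ⊆X X = All (_∈X X) ps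

{-# OPTIONS --safe #-}
module Submission where

-- Support in PL(=(·)) is closed under subteams, and a team in which all
-- valuations coincide supports every dependence atom, so on such teams φ and
-- its flattening agree.  Flattening only weakens dependence atoms to ⊤ (with
-- the same anti-support), hence |φ| ⊆ |φ^f|.  Conversely, if v lies in a team
-- supporting φ^f, its restriction to the valuations equal to v still supports
-- φ^f, hence φ, and contains v.

open import Defs
open import Data.Product using (_×_; _,_; proj₁; proj₂)
open import Data.Sum using (_⊎_; inj₁; inj₂; [_,_]′)
open import Data.Unit using (tt)
open import Level using (lift)
open import Relation.Unary using (_⊆_; _∩_)
open import Relation.Binary.PropositionalEquality using (_≡_; refl; trans; sym)

module _ {X : VarSet} where

  _≐_ : Val X → Val X → Set
  v ≐ w = ∀ p (h : p ∈X X) → v p h ≡ w p h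

  Constant : Team X → Set
  Constant s = ∀ {v w} → s v → s w → v ≐ w

  ∪-⊆ˡ : {s t u : Team X} → IsUnion s t u → t ⊆ s
  ∪-⊆ˡ s=t∪u {v} tv = proj₂ (s=t∪u v) (inj₁ tv)

  ∪-⊆ʳ : {s t u : Team X} → IsUnion s t u → u ⊆ s
  ∪-⊆ʳ s=t∪u {v} uv = proj₂ (s=t∪u v) (inj₂ uv)

  ∪-restrict : {s s′ t u : Team X} → s′ ⊆ s → IsUnion s t u →
               IsUnion s′ (s′ ∩ t) (s′ ∩ u)
  ∪-restrict {_} {s′} {t} {u} s′⊆s s=t∪u v = split , [ proj₁ , proj₁ ]′
    where
    split : s′ v → (s′ ∩ t) v ⊎ (s′ ∩ u) v
    split s′v with proj₁ (s=t∪u v) (s′⊆s s′v)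
    ... | inj₁ tv = inj₁ (s′v , tv)
    ... | inj₂ uv = inj₂ (s′v , uv)

  Constant-⊆ : {s t : Team X} → t ⊆ s → Constant s → Constant t
  Constant-⊆ t⊆s const tv tw = const (t⊆s tv) (t⊆s tw)

  mutual
    ⊨-downward-closed : ∀ φ {s t : Team X} → t ⊆ s → s ⊨ φ → t ⊨ φ
    ⊨-downward-closed (var p)    t⊆s (lift sp)  = lift λ v tv → sp v (t⊆s tv)
    ⊨-downward-closed ⊥f         t⊆s (lift s∅)  = lift λ v tv → s∅ v (t⊆s tv)
    ⊨-downward-closed (¬f φ)     t⊆s s⊨¬φ       = ⊨⁻-downward-closed φ t⊆s s⊨¬φ
    ⊨-downward-closed (φ ∧f ψ)   t⊆s (s⊨φ , s⊨ψ) =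
      ⊨-downward-closed φ t⊆s s⊨φ , ⊨-downward-closed ψ t⊆s s⊨ψ
    ⊨-downward-closed (φ ∨f ψ)   t⊆s (s₁ , s₂ , s=s₁∪s₂ , s₁⊨φ , s₂⊨ψ) =
      _ , _ , ∪-restrict t⊆s s=s₁∪s₂ ,
      ⊨-downward-closed φ proj₂ s₁⊨φ , ⊨-downward-closed ψ proj₂ s₂⊨ψ
    ⊨-downward-closed (dep ps q) t⊆s (lift s⊨dep) =
      lift λ v w tv tw → s⊨dep v w (t⊆s tv) (t⊆s tw)

    ⊨⁻-downward-closed : ∀ φ {s t : Team X} → t ⊆ s → s ⊨⁻ φ → t ⊨⁻ φ
    ⊨⁻-downward-closed (var p)    t⊆s (lift s¬p) = lift λ v tv → s¬p v (t⊆s tv)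
    ⊨⁻-downward-closed ⊥f         t⊆s _          = lift tt
    ⊨⁻-downward-closed (¬f φ)     t⊆s s⊨φ        = ⊨-downward-closed φ t⊆s s⊨φ
    ⊨⁻-downward-closed (φ ∧f ψ)   t⊆s (s₁ , s₂ , s=s₁∪s₂ , s₁⊨⁻φ , s₂⊨⁻ψ) =
      _ , _ , ∪-restrict t⊆s s=s₁∪s₂ ,
      ⊨⁻-downward-closed φ proj₂ s₁⊨⁻φ , ⊨⁻-downward-closed ψ proj₂ s₂⊨⁻ψ
    ⊨⁻-downward-closed (φ ∨f ψ)   t⊆s (s⊨⁻φ , s⊨⁻ψ) =
      ⊨⁻-downward-closed φ t⊆s s⊨⁻φ , ⊨⁻-downward-closed ψ t⊆s s⊨⁻ψ
    ⊨⁻-downward-closed (dep ps q) t⊆s (lift s∅) = lift λ v tv → s∅ v (t⊆s tv)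

  mutual
    ⊨-flat : ∀ φ {s : Team X} → s ⊨ φ → s ⊨ flat φ
    ⊨-flat (var p)    s⊨p            = s⊨p
    ⊨-flat ⊥f         s⊨⊥            = s⊨⊥
    ⊨-flat (¬f φ)     s⊨⁻φ           = ⊨⁻-flat φ s⊨⁻φ
    ⊨-flat (φ ∧f ψ)   (s⊨φ , s⊨ψ)    = ⊨-flat φ s⊨φ , ⊨-flat ψ s⊨ψ
    ⊨-flat (φ ∨f ψ)   (s₁ , s₂ , s=s₁∪s₂ , s₁⊨φ , s₂⊨ψ) =
      s₁ , s₂ , s=s₁∪s₂ , ⊨-flat φ s₁⊨φ , ⊨-flat ψ s₂⊨ψ
    ⊨-flat (dep ps q) _              = lift tt

    ⊨⁻-flat : ∀ φ {s : Team X} → s ⊨⁻ φ → s ⊨⁻ flat φ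
    ⊨⁻-flat (var p)    s⊨⁻p          = s⊨⁻p
    ⊨⁻-flat ⊥f         s⊨⁻⊥          = s⊨⁻⊥
    ⊨⁻-flat (¬f φ)     s⊨φ           = ⊨-flat φ s⊨φ
    ⊨⁻-flat (φ ∧f ψ)   (s₁ , s₂ , s=s₁∪s₂ , s₁⊨⁻φ , s₂⊨⁻ψ) =
      s₁ , s₂ , s=s₁∪s₂ , ⊨⁻-flat φ s₁⊨⁻φ , ⊨⁻-flat ψ s₂⊨⁻ψ
    ⊨⁻-flat (φ ∨f ψ)   (s⊨⁻φ , s⊨⁻ψ) = ⊨⁻-flat φ s⊨⁻φ , ⊨⁻-flat ψ s⊨⁻ψ
    ⊨⁻-flat (dep ps q) s∅            = s∅

  mutual
    flat-⊨-constant : ∀ φ {s : Team X} → Constant s → s ⊨ flat φ → s ⊨ φ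
    flat-⊨-constant (var p)    const s⊨p         = s⊨p
    flat-⊨-constant ⊥f         const s⊨⊥         = s⊨⊥
    flat-⊨-constant (¬f φ)     const s⊨⁻φ        = flat-⊨⁻-constant φ const s⊨⁻φ
    flat-⊨-constant (φ ∧f ψ)   const (s⊨φ , s⊨ψ) =
      flat-⊨-constant φ const s⊨φ , flat-⊨-constant ψ const s⊨ψ
    flat-⊨-constant (φ ∨f ψ)   const (s₁ , s₂ , s=s₁∪s₂ , s₁⊨φ , s₂⊨ψ) =
      s₁ , s₂ , s=s₁∪s₂ ,
      flat-⊨-constant φ (Constant-⊆ (∪-⊆ˡ s=s₁∪s₂) const) s₁⊨φ ,
      flat-⊨-constant ψ (Constant-⊆ (∪-⊆ʳ s=s₁∪s₂) const) s₂⊨ψ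
    flat-⊨-constant (dep ps q) const _           = lift λ v w sv sw _ → const sv sw q

    flat-⊨⁻-constant : ∀ φ {s : Team X} → Constant s → s ⊨⁻ flat φ → s ⊨⁻ φ
    flat-⊨⁻-constant (var p)    const s⊨⁻p          = s⊨⁻p
    flat-⊨⁻-constant ⊥f         const s⊨⁻⊥          = s⊨⁻⊥
    flat-⊨⁻-constant (¬f φ)     const s⊨φ           = flat-⊨-constant φ const s⊨φ
    flat-⊨⁻-constant (φ ∧f ψ)   const (s₁ , s₂ , s=s₁∪s₂ , s₁⊨⁻φ , s₂⊨⁻ψ) =
      s₁ , s₂ , s=s₁∪s₂ ,
      flat-⊨⁻-constant φ (Constant-⊆ (∪-⊆ˡ s=s₁∪s₂) const) s₁⊨⁻φ ,
      flat-⊨⁻-constant ψ (Constant-⊆ (∪-⊆ʳ s=s₁∪s₂) const) s₂⊨⁻ψ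
    flat-⊨⁻-constant (φ ∨f ψ)   const (s⊨⁻φ , s⊨⁻ψ) =
      flat-⊨⁻-constant φ const s⊨⁻φ , flat-⊨⁻-constant ψ const s⊨⁻ψ
    flat-⊨⁻-constant (dep ps q) const s∅            = s∅

  ∩≐-constant : (s : Team X) (v : Val X) → Constant (s ∩ (_≐ v))
  ∩≐-constant s v (_ , u≐v) (_ , w≐v) p h = trans (u≐v p h) (sym (w≐v p h))

lemma3p29 : (φ : Form) (X : VarSet) → P φ ⊆X X →
    (v : Val X) → (Ground φ X v → Ground (flat φ) X v) × (Ground (flat φ) X v → Ground φ X v)
lemma3p29 φ X _ v = ground-flat , flat-ground
  where
  ground-flat : Ground φ X v → Ground (flat φ) X v
  ground-flat (s , s⊨φ , sv) = s , ⊨-flat φ s⊨φ , sv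

  flat-ground : Ground (flat φ) X v → Ground φ X v
  flat-ground (s , s⊨φᶠ , sv) = s ∩ (_≐ v) , s∩v⊨φ , sv , (λ p h → refl)
    where
    s∩v⊨φ : (s ∩ (_≐ v)) ⊨ φ
    s∩v⊨φ = flat-⊨-constant φ (∩≐-constant s v)
              (⊨-downward-closed (flat φ) proj₁ s⊨φᶠ)
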